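{- Let $G$ be a graph whose coarsest equitable partition consists of two parts, with parameters $v=(v_1,v_2)^t$ and $D=\begin{bmatrix}D_{11}&D_{12}\\ D_{21}&D_{22}\end{bmatrix}$ (so $v_1D_{12}=v_2D_{21}$). Let $H$ be another graph whose coarsest equitable partition has the same parameters. Then $G\equiv H$.
   Context: Graphs are finite and simple. For a vertex $x$ and a set $W$ of vertices, $d(x,W)=|N(x)\cap W|$. A partition $\{V_1,\dots,V_s\}$ of $V(G)$ is equitable if for all $i,j$ and all $x,y\in V_i$, $d(x,V_j)=d(y,V_j)$. Every graph has a unique coarsest equitable partition (maximum under refinement). The parameters of an equitable partition $\{P_1,\dots,P_p\}$ are $(v,D)$, where $v$ is the $p$-vector with $v_i=|P_i|$ and $D$ is the $p\times p$ matrix with $D_{ij}=d(x,P_j)$ for any $x\in P_i$; two partitions have the same parameters if their parts can be indexed so that the parameters coincide. A hypergraph $G=(V,X)$ consists of a finite vertex set $V$ and a family $X$ of subsets of $V$; graphs are the $2$-uniform hypergraphs. If $G$ has $n$ vertices and $m\ge1$ hyperedges, its vertex-hyperedge incidence matrix $M_G\in\{0,1\}^{n\times m}$ has $(i,j)$ entry $1$ iff vertex $i$ belongs to hyperedge $j$. A doubly stochastic matrix is a square nonnegative matrix whose rows and columns each sum to $1$. For hypergraphs $G,H$, write $G\equiv H$ if either $G$ and $H$ have the same number of vertices and no hyperedges, or there exist doubly stochastic matrices $S_1,S_2$ with $S_1M_G=M_HS_2^t$ and $M_GS_2=S_1^tM_H$. -}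

module Defs where

open import Data.Nat using (ℕ; zero; suc; _+_)
open import Data.Nat.Properties using ()
open import Data.Bool using (Bool; true; false; _∧_; _∨_; if_then_else_)
open import Data.Fin using (Fin; zero; suc; _<?_; _≟_)
open import Data.Product using (Σ; ∃; _×_; _,_; proj₁; proj₂)
open import Data.Sum using (_⊎_)
open import Data.List using (List; length; lookup; filterᵇ; cartesianProduct; allFin)
open import Data.Rational using (ℚ; 0ℚ; 1ℚ; _≤_) renaming (_+_ to _+ℚ_; _*_ to _*ℚ_)
open import Function.Bundles using (_↔_; Inverse)
open import Relation.Nullary.Decidable using (⌊_⌋)
open import Relation.Binary.PropositionalEquality using (_≡_)

sumℚ : ∀ n → (Fin n → ℚ) → ℚ
sumℚ zero    f = 0ℚ
sumℚ (suc n) f = f zero +ℚ sumℚ n (λ i → f (suc i))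

count : ∀ n → (Fin n → Bool) → ℕ
count zero    f = 0
count (suc n) f = (if f zero then 1 else 0) + count n (λ i → f (suc i))

record Graph (n : ℕ) : Set where
  field
    adj   : Fin n → Fin n → Bool
    sym   : ∀ x y → adj x y ≡ adj y x
    irrefl : ∀ x → adj x x ≡ false
open Graph public

IsPartition : ∀ {n s} → (Fin n → Fin s) → Set
IsPartition {s = s} p = ∀ (i : Fin s) → ∃ λ x → p x ≡ i

deg : ∀ {n s} → Graph n → (Fin n → Fin s) → Fin n → Fin s → ℕ
deg {n} G p x j = count n (λ y → adj G x y ∧ ⌊ p y ≟ j ⌋)

IsEquitable : ∀ {n s} → Graph n → (Fin n → Fin s) → Set
IsEquitable {s = s} G p =
  IsPartition p × (∀ x y → p x ≡ p y → ∀ (j : Fin s) → deg G p x j ≡ deg G p y j)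

Refines : ∀ {n s t} → (Fin n → Fin t) → (Fin n → Fin s) → Set
Refines q p = ∀ x y → q x ≡ q y → p x ≡ p y

IsCoarsestEquitable : ∀ {n s} → Graph n → (Fin n → Fin s) → Set
IsCoarsestEquitable {n} G p =
  IsEquitable G p × (∀ t (q : Fin n → Fin t) → IsEquitable G q → Refines q p)

partSize : ∀ {n s} → (Fin n → Fin s) → Fin s → ℕ
partSize {n} p i = count n (λ x → ⌊ p x ≟ i ⌋)

-- Equitable partitions p (of G) and q (of H) have the same parameters (v, D):
-- there is a re-indexing σ of the parts with v_i = v'_{σ i} and
-- D_{ij} = D'_{σ i, σ j} (D_{ij} = d(x,P_j) for any x ∈ P_i).
SameParameters : ∀ {n n' s} → Graph n → (Fin n → Fin s) → Graph n' → (Fin n' → Fin s) → Set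
SameParameters {n} {n'} {s} G p H q =
  Σ (Fin s ↔ Fin s) λ σ → let f = Inverse.to σ in
    (∀ i → partSize p i ≡ partSize q (f i)) ×
    (∀ (x : Fin n) (y : Fin n') → f (p x) ≡ q y →
       ∀ j → deg G p x j ≡ deg H q y (f j))

record Hypergraph : Set where
  field
    nV  : ℕ
    nE  : ℕ
    inc : Fin nV → Fin nE → Bool
open Hypergraph public

edgeList : ∀ {n} → Graph n → List (Fin n × Fin n)
edgeList {n} G = filterᵇ (λ e → ⌊ proj₁ e <? proj₂ e ⌋ ∧ adj G (proj₁ e) (proj₂ e))
                         (cartesianProduct (allFin n) (allFin n))

toHypergraph : ∀ {n} → Graph n → Hypergraph
toHypergraph {n} G = record
  { nV = n
  ; nE = length (edgeList G)
  ; inc = λ v e → ⌊ v ≟ proj₁ (lookup (edgeList G) e) ⌋ ∨ ⌊ v ≟ proj₂ (lookup (edgeList G) e) ⌋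
  }

incMat : (G : Hypergraph) → Fin (nV G) → Fin (nE G) → ℚ
incMat G v e = if inc G v e then 1ℚ else 0ℚ

DoublyStochastic : ∀ {a b} → (Fin a → Fin b → ℚ) → Set
DoublyStochastic {a} {b} S =
  (a ≡ b) × (∀ i j → 0ℚ ≤ S i j) ×
  (∀ i → sumℚ b (λ j → S i j) ≡ 1ℚ) × (∀ j → sumℚ a (λ i → S i j) ≡ 1ℚ)

_≡ᴴ_ : Hypergraph → Hypergraph → Set
G ≡ᴴ H =
  (nV G ≡ nV H × nE G ≡ 0 × nE H ≡ 0)
  ⊎ Σ (Fin (nV H) → Fin (nV G) → ℚ) λ S₁ → Σ (Fin (nE G) → Fin (nE H) → ℚ) λ S₂ →
      DoublyStochastic S₁ × DoublyStochastic S₂ ×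
      (∀ i e → sumℚ (nV G) (λ k → S₁ i k *ℚ incMat G k e)
             ≡ sumℚ (nE H) (λ f → incMat H i f *ℚ S₂ e f)) ×
      (∀ k f → sumℚ (nE G) (λ e → incMat G k e *ℚ S₂ e f)
             ≡ sumℚ (nV H) (λ i → S₁ i k *ℚ incMat H i f))

-- S₁ averages uniformly over corresponding parts of the two partitions and S₂ averages
-- uniformly over edges of the same type, where the type of an edge is the multiset of the
-- parts containing its ends. Writing v_c for the size of part c, N_t for the number of edges
-- of type t, ρ(c,t) for the number of ends of a type-t edge lying in part c and δ(c,t) for
-- the number of type-t edges at a vertex of part c, the entries of both sides of
-- S₁M_G = M_HS₂ᵗ and of M_GS₂ = S₁ᵗM_H are ρ(c,t)/v_c and δ(c,t)/N_t. These agree because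
-- double counting the incidences between part c and the edges of type t gives
-- v_c δ(c,t) = N_t ρ(c,t); the same identity shows that N_t is determined by the parameters,
-- so it is the same in G and in H.
module Submission where

open import Algebra.Bundles using (Monoid; Ring)
import Algebra.Definitions.RawMonoid
import Algebra.Properties.Group
import Algebra.Properties.Monoid.Sum
import Algebra.Properties.Semiring.Mult
import Algebra.Properties.Semiring.Sum
open import Data.Bool using (Bool; true; false; _∧_; _∨_; if_then_else_)
open import Data.Bool.Properties using (∧-zeroʳ; ∧-assoc; ∧-conicalˡ)
open import Data.Fin using (Fin; zero; suc; _≟_; _<?_; toℕ)
open import Data.Fin.Properties using (suc-injective; <-irrefl; <-cmp)
open import Data.List using (List; []; _∷_; length; lookup; filterᵇ; map; _++_; tabulate; cartesianProduct; allFin)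
open import Data.Nat using (ℕ; zero; suc; _+_; _*_; _∸_)
import Data.Nat
import Data.Nat.Properties as ℕ
open import Data.Product using (_×_; _,_; proj₁; proj₂)
open import Data.Rational using (ℚ; 0ℚ; 1ℚ; _≤_; 1/_; Positive; NonNegative) renaming (_+_ to _+ℚ_; _*_ to _*ℚ_)
import Data.Rational
import Data.Rational.Properties as ℚ
open import Data.Rational.Solver using (module +-*-Solver)
open import Data.Sum using (inj₂)
open import Function using (_∘_; _⇔_; mk⇔; Inverse)
open import Relation.Binary.Definitions using (DecidableEquality; tri<; tri≈; tri>)
open import Relation.Binary.PropositionalEquality
open import Relation.Nullary using (Dec; yes; no; ¬_)
open import Relation.Nullary.Decidable using (⌊_⌋; does-⇔; isYes≗does)
open import Relation.Nullary.Negation using (contradiction)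
open import Defs hiding (sym)

private
  module ℕΣ = Algebra.Properties.Semiring.Sum ℕ.+-*-semiring
  module ℚΣ = Algebra.Properties.Semiring.Sum (Ring.semiring ℚ.+-*-ring)
  module ℚ+ = Algebra.Properties.Group ℚ.+-0-group

open ℕΣ using (sum-syntax; sum-cong-≗; ∑-distrib-+; ∑-comm)
open Algebra.Definitions.RawMonoid Data.Nat.+-0-rawMonoid using () renaming (_×_ to _×ℕ_)
open Algebra.Definitions.RawMonoid Data.Rational.+-0-rawMonoid using () renaming (_×_ to _×ℚ_)
open Algebra.Properties.Semiring.Mult (Ring.semiring ℚ.+-*-ring) using (×-assoc-*; ×1-homo-*)

indicator : Bool → ℕ
indicator b = if b then 1 else 0

⌊⌋-yes : ∀ {A : Set} (a? : Dec A) → A → ⌊ a? ⌋ ≡ true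
⌊⌋-yes (yes _) _ = refl
⌊⌋-yes (no ¬a) a = contradiction a ¬a

⌊⌋-no : ∀ {A : Set} (a? : Dec A) → ¬ A → ⌊ a? ⌋ ≡ false
⌊⌋-no (yes a) ¬a = contradiction a ¬a
⌊⌋-no (no _)  _  = refl

⌊⌋-true⇒ : ∀ {A : Set} (a? : Dec A) → ⌊ a? ⌋ ≡ true → A
⌊⌋-true⇒ (yes a) _ = a

⌊⌋-⇔ : ∀ {A B : Set} → A ⇔ B → (a? : Dec A) (b? : Dec B) → ⌊ a? ⌋ ≡ ⌊ b? ⌋
⌊⌋-⇔ A⇔B a? b? = trans (isYes≗does a?) (trans (does-⇔ A⇔B a? b?) (sym (isYes≗does b?)))

⌊≟⌋-sym : ∀ {A : Set} (_≟ᴬ_ : DecidableEquality A) (x y : A) → ⌊ x ≟ᴬ y ⌋ ≡ ⌊ y ≟ᴬ x ⌋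
⌊≟⌋-sym _≟ᴬ_ x y = ⌊⌋-⇔ (mk⇔ sym sym) (x ≟ᴬ y) (y ≟ᴬ x)

⌊suc≟suc⌋ : ∀ {N} (x y : Fin N) → ⌊ suc x ≟ suc y ⌋ ≡ ⌊ x ≟ y ⌋
⌊suc≟suc⌋ x y = ⌊⌋-⇔ (mk⇔ suc-injective (cong suc)) (suc x ≟ suc y) (x ≟ y)

module MonoidSums {c ℓ} (M : Monoid c ℓ) where
  open Monoid M using (Carrier; _≈_; _∙_; ε; ∙-cong; identityˡ; rawMonoid)
    renaming (refl to ≈-refl; trans to ≈-trans)
  private module Σᴹ = Algebra.Properties.Monoid.Sum M
  open import Algebra.Definitions.RawMonoid rawMonoid using () renaming (_×_ to _·_)

  ∑-if : ∀ N (B : Fin N → Bool) (f : Fin N → Carrier) x → (∀ k → B k ≡ true → f k ≈ x) →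
         Σᴹ.sum (λ k → if B k then f k else ε) ≈ count N B · x
  ∑-if zero    B f x h = ≈-refl
  ∑-if (suc N) B f x h with B zero in B₀
  ... | true  = ∙-cong (h zero B₀) (∑-if N (B ∘ suc) (f ∘ suc) x (h ∘ suc))
  ... | false = ≈-trans (identityˡ _) (∑-if N (B ∘ suc) (f ∘ suc) x (h ∘ suc))

private module ℕ-Sums = MonoidSums ℕ.+-0-monoid

count≡∑ : ∀ N (B : Fin N → Bool) → count N B ≡ ∑[ k < N ] indicator (B k)
count≡∑ zero    B = refl
count≡∑ (suc N) B = cong (indicator (B zero) +_) (count≡∑ N (B ∘ suc))

count-cong : ∀ N {B B′ : Fin N → Bool} → (∀ k → B k ≡ B′ k) → count N B ≡ count N B′
count-cong N {B} {B′} h = begin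
  count N B                         ≡⟨ count≡∑ N B ⟩
  ∑[ k < N ] indicator (B k)        ≡⟨ sum-cong-≗ (cong indicator ∘ h) ⟩
  ∑[ k < N ] indicator (B′ k)       ≡⟨ count≡∑ N B′ ⟨
  count N B′                        ∎
  where open ≡-Reasoning

×ℕ≡* : ∀ m n → m ×ℕ n ≡ m * n
×ℕ≡* zero    n = refl
×ℕ≡* (suc m) n = cong (n +_) (×ℕ≡* m n)

∑-if : ∀ N (B : Fin N → Bool) (f : Fin N → ℕ) x → (∀ k → B k ≡ true → f k ≡ x) →
       ∑[ k < N ] (if B k then f k else 0) ≡ count N B * x
∑-if N B f x h = trans (ℕ-Sums.∑-if N B f x h) (×ℕ≡* (count N B) x)

∑-if-≟ : ∀ N (x : Fin N) (f : Fin N → ℕ) → ∑[ j < N ] (if ⌊ x ≟ j ⌋ then f j else 0) ≡ f x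
∑-if-≟ (suc N) zero    f = trans (cong (f zero +_) (ℕΣ.sum-replicate-zero N)) (ℕ.+-identityʳ (f zero))
∑-if-≟ (suc N) (suc x) f = trans
  (sum-cong-≗ λ j → cong (λ b → if b then f (suc j) else 0) (⌊suc≟suc⌋ x j))
  (∑-if-≟ N x (f ∘ suc))

∑-if-const : ∀ N b (u : Fin N → ℕ) → ∑[ k < N ] (if b then u k else 0) ≡ (if b then ∑[ k < N ] u k else 0)
∑-if-const N true  u = refl
∑-if-const N false u = ℕΣ.sum-replicate-zero N

count-false : ∀ N → count N (λ _ → false) ≡ 0
count-false zero    = refl
count-false (suc N) = count-false N

count-∧-if : ∀ N (A B : Fin N → Bool) b →
             count N (λ k → A k ∧ (b ∧ B k)) ≡ (if b then count N (λ k → A k ∧ B k) else 0)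
count-∧-if N A B true  = refl
count-∧-if N A B false = trans (count-cong N (λ k → ∧-zeroʳ (A k))) (count-false N)

count-nonzero : ∀ N (B : Fin N → Bool) x → B x ≡ true → count N B ≢ 0
count-nonzero (suc N) B x Bx with B zero in B₀
count-nonzero (suc N) B x       Bx | true  = λ ()
count-nonzero (suc N) B zero    Bx | false = contradiction (trans (sym B₀) Bx) λ ()
count-nonzero (suc N) B (suc x) Bx | false = count-nonzero N (B ∘ suc) x Bx

∑-count-comm : ∀ a b (R : Fin a → Fin b → Bool) → ∑[ k < a ] count b (R k) ≡ ∑[ e < b ] count a (λ k → R k e)
∑-count-comm a b R = begin
  ∑[ k < a ] count b (R k)                     ≡⟨ sum-cong-≗ {a} (λ k → count≡∑ b (R k)) ⟩
  ∑[ k < a ] ∑[ e < b ] indicator (R k e)      ≡⟨ ∑-comm {a} {b} _ ⟩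
  ∑[ e < b ] ∑[ k < a ] indicator (R k e)      ≡⟨ sum-cong-≗ {b} (λ e → count≡∑ a (λ k → R k e)) ⟨
  ∑[ e < b ] count a (λ k → R k e)             ∎
  where open ≡-Reasoning

indicator-∧-∨ : ∀ P x y → P ∧ (x ∧ y) ≡ false →
                indicator (P ∧ (x ∨ y)) ≡ (if x then indicator P else 0) + (if y then indicator P else 0)
indicator-∧-∨ true  true  true  ()
indicator-∧-∨ true  true  false _ = refl
indicator-∧-∨ true  false true  _ = refl
indicator-∧-∨ true  false false _ = refl
indicator-∧-∨ false true  true  _ = refl
indicator-∧-∨ false true  false _ = refl
indicator-∧-∨ false false true  _ = refl
indicator-∧-∨ false false false _ = refl

count-∧-either : ∀ N (P : Fin N → Bool) {a b} → a ≢ b →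
                 count N (λ k → P k ∧ (⌊ k ≟ a ⌋ ∨ ⌊ k ≟ b ⌋)) ≡ indicator (P a) + indicator (P b)
count-∧-either N P {a} {b} a≢b = begin
  count N (λ k → P k ∧ (⌊ k ≟ a ⌋ ∨ ⌊ k ≟ b ⌋))
    ≡⟨ count≡∑ N _ ⟩
  ∑[ k < N ] indicator (P k ∧ (⌊ k ≟ a ⌋ ∨ ⌊ k ≟ b ⌋))
    ≡⟨ sum-cong-≗ (λ k → indicator-∧-∨ (P k) ⌊ k ≟ a ⌋ ⌊ k ≟ b ⌋ (trans (cong (P k ∧_) (disjoint k)) (∧-zeroʳ (P k)))) ⟩
  ∑[ k < N ] ((if ⌊ k ≟ a ⌋ then indicator (P k) else 0) + (if ⌊ k ≟ b ⌋ then indicator (P k) else 0))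
    ≡⟨ ∑-distrib-+ {N} _ _ ⟩
  ∑[ k < N ] (if ⌊ k ≟ a ⌋ then indicator (P k) else 0) + ∑[ k < N ] (if ⌊ k ≟ b ⌋ then indicator (P k) else 0)
    ≡⟨ cong₂ _+_ (picks a) (picks b) ⟩
  indicator (P a) + indicator (P b)
    ∎
  where
  open ≡-Reasoning
  disjoint : ∀ k → ⌊ k ≟ a ⌋ ∧ ⌊ k ≟ b ⌋ ≡ false
  disjoint k with k ≟ a | k ≟ b
  ... | yes refl | yes refl = contradiction refl a≢b
  ... | yes _    | no _     = refl
  ... | no _     | _        = refl
  picks : ∀ x → ∑[ k < N ] (if ⌊ k ≟ x ⌋ then indicator (P k) else 0) ≡ indicator (P x)
  picks x = trans (sum-cong-≗ λ k → cong (λ c → if c then indicator (P k) else 0) (⌊≟⌋-sym _≟_ k x))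
                  (∑-if-≟ N x (indicator ∘ P))

if-indicator-∧ : ∀ A x y → (if x then indicator (A ∧ y) else 0) ≡ (if y then indicator (A ∧ x) else 0)
if-indicator-∧ A true  true  = refl
if-indicator-∧ A true  false = cong indicator (∧-zeroʳ A)
if-indicator-∧ A false true  = sym (cong indicator (∧-zeroʳ A))
if-indicator-∧ A false false = refl

count-∧-fibres : ∀ N s (A : Fin N → Bool) (f : Fin N → Fin s) (g : Fin s → Bool) →
  count N (λ k → A k ∧ g (f k)) ≡ ∑[ j < s ] (if g j then count N (λ k → A k ∧ ⌊ f k ≟ j ⌋) else 0)
count-∧-fibres N s A f g = begin
  count N (λ k → A k ∧ g (f k))
    ≡⟨ count≡∑ N _ ⟩
  ∑[ k < N ] indicator (A k ∧ g (f k))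
    ≡⟨ sum-cong-≗ (λ k → ∑-if-≟ s (f k) (λ j → indicator (A k ∧ g j))) ⟨
  ∑[ k < N ] ∑[ j < s ] (if ⌊ f k ≟ j ⌋ then indicator (A k ∧ g j) else 0)
    ≡⟨ ∑-comm {N} {s} _ ⟩
  ∑[ j < s ] ∑[ k < N ] (if ⌊ f k ≟ j ⌋ then indicator (A k ∧ g j) else 0)
    ≡⟨ sum-cong-≗ (λ j → sum-cong-≗ λ k → if-indicator-∧ (A k) _ (g j)) ⟩
  ∑[ j < s ] ∑[ k < N ] (if g j then indicator (A k ∧ ⌊ f k ≟ j ⌋) else 0)
    ≡⟨ sum-cong-≗ (λ j → ∑-if-const N (g j) _) ⟩
  ∑[ j < s ] (if g j then ∑[ k < N ] indicator (A k ∧ ⌊ f k ≟ j ⌋) else 0)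
    ≡⟨ sum-cong-≗ (λ j → cong (λ c → if g j then c else 0) (count≡∑ N _)) ⟨
  ∑[ j < s ] (if g j then count N (λ k → A k ∧ ⌊ f k ≟ j ⌋) else 0)
    ∎
  where open ≡-Reasoning

countᴸ : ∀ {A : Set} → (A → Bool) → List A → ℕ
countᴸ g xs = count (length xs) (g ∘ lookup xs)

countᴸ-filterᵇ : ∀ {A : Set} (h g : A → Bool) xs → countᴸ g (filterᵇ h xs) ≡ countᴸ (λ x → h x ∧ g x) xs
countᴸ-filterᵇ h g []       = refl
countᴸ-filterᵇ h g (x ∷ xs) with h x
... | true  = cong (indicator (g x) +_) (countᴸ-filterᵇ h g xs)
... | false = countᴸ-filterᵇ h g xs

countᴸ-++ : ∀ {A : Set} (g : A → Bool) xs ys → countᴸ g (xs ++ ys) ≡ countᴸ g xs + countᴸ g ys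
countᴸ-++ g []       ys = refl
countᴸ-++ g (x ∷ xs) ys = trans (cong (indicator (g x) +_) (countᴸ-++ g xs ys)) (sym (ℕ.+-assoc (indicator (g x)) _ _))

countᴸ-map : ∀ {A B : Set} (g : B → Bool) (f : A → B) xs → countᴸ g (map f xs) ≡ countᴸ (g ∘ f) xs
countᴸ-map g f []       = refl
countᴸ-map g f (x ∷ xs) = cong (indicator (g (f x)) +_) (countᴸ-map g f xs)

countᴸ-tabulate : ∀ {A : Set} N (g : A → Bool) (f : Fin N → A) → countᴸ g (tabulate f) ≡ count N (g ∘ f)
countᴸ-tabulate zero    g f = refl
countᴸ-tabulate (suc N) g f = cong (indicator (g (f zero)) +_) (countᴸ-tabulate N g (f ∘ suc))

countᴸ-cartesianProduct : ∀ {A B : Set} N (g : A × B → Bool) (f : Fin N → A) ys →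
  countᴸ g (cartesianProduct (tabulate f) ys) ≡ ∑[ a < N ] countᴸ (λ y → g (f a , y)) ys
countᴸ-cartesianProduct zero    g f ys = refl
countᴸ-cartesianProduct (suc N) g f ys = trans (countᴸ-++ g (map (f zero ,_) ys) _)
  (cong₂ _+_ (countᴸ-map g (f zero ,_) ys) (countᴸ-cartesianProduct N g (f ∘ suc) ys))

lookup-filterᵇ : ∀ {A : Set} (h : A → Bool) xs i → h (lookup (filterᵇ h xs) i) ≡ true
lookup-filterᵇ h (x ∷ xs) i with h x in hx
lookup-filterᵇ h (x ∷ xs) zero    | true  = hx
lookup-filterᵇ h (x ∷ xs) (suc i) | true  = lookup-filterᵇ h xs i
lookup-filterᵇ h (x ∷ xs) i       | false = lookup-filterᵇ h xs i

private module ℚ-Sums = MonoidSums ℚ.+-0-monoid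

sumℚ≡∑ : ∀ N (f : Fin N → ℚ) → sumℚ N f ≡ ℚΣ.sum f
sumℚ≡∑ zero    f = refl
sumℚ≡∑ (suc N) f = cong (f zero +ℚ_) (sumℚ≡∑ N (f ∘ suc))

sumℚ-cong : ∀ N {f g : Fin N → ℚ} → (∀ k → f k ≡ g k) → sumℚ N f ≡ sumℚ N g
sumℚ-cong zero    h = refl
sumℚ-cong (suc N) h = cong₂ _+ℚ_ (h zero) (sumℚ-cong N (h ∘ suc))

sumℚ-if : ∀ N (B : Fin N → Bool) (f : Fin N → ℚ) x → (∀ k → B k ≡ true → f k ≡ x) →
          sumℚ N (λ k → if B k then f k else 0ℚ) ≡ count N B ×ℚ x
sumℚ-if N B f x h = trans (sumℚ≡∑ N _) (ℚ-Sums.∑-if N B f x h)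

×ℚ1-nonNegative : ∀ n → NonNegative (n ×ℚ 1ℚ)
×ℚ1-nonNegative zero    = _
×ℚ1-nonNegative (suc n) = ℚ.nonNeg+nonNeg⇒nonNeg 1ℚ (n ×ℚ 1ℚ) {{×ℚ1-nonNegative n}}

suc×ℚ1-positive : ∀ n → Positive (suc n ×ℚ 1ℚ)
suc×ℚ1-positive n = ℚ.pos+nonNeg⇒pos 1ℚ (n ×ℚ 1ℚ) {{×ℚ1-nonNegative n}}

-- 1/n, with the junk value recip 0 = 0.
recip : ℕ → ℚ
recip zero    = 0ℚ
recip (suc n) = 1/ (suc n ×ℚ 1ℚ)
  where instance _ = ℚ.pos⇒nonZero (suc n ×ℚ 1ℚ) {{suc×ℚ1-positive n}}

recip-nonNegative : ∀ n → 0ℚ ≤ recip n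
recip-nonNegative zero    = ℚ.≤-refl
recip-nonNegative (suc n) = ℚ.nonNegative⁻¹ (recip (suc n))
  {{ℚ.pos⇒nonNeg (recip (suc n)) {{ℚ.1/pos⇒pos (suc n ×ℚ 1ℚ) {{suc×ℚ1-positive n}}}}}}

×ℚ≡*ℚ : ∀ n q → n ×ℚ q ≡ (n ×ℚ 1ℚ) *ℚ q
×ℚ≡*ℚ n q = trans (cong (n ×ℚ_) (sym (ℚ.*-identityˡ q))) (sym (×-assoc-* n 1ℚ q))

×ℚ-recip : ∀ n → n ≢ 0 → n ×ℚ recip n ≡ 1ℚ
×ℚ-recip zero    n≢0 = contradiction refl n≢0
×ℚ-recip (suc n) _   = trans (×ℚ≡*ℚ (suc n) _) (ℚ.*-inverseʳ (suc n ×ℚ 1ℚ) {{ℚ.pos⇒nonZero (suc n ×ℚ 1ℚ) {{suc×ℚ1-positive n}}}})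

×ℚ-recip-cross : ∀ a b x y → x ≢ 0 → y ≢ 0 → x * b ≡ y * a → a ×ℚ recip x ≡ b ×ℚ recip y
×ℚ-recip-cross a b x y x≢0 y≢0 xb≡ya = begin
  a ×ℚ recip x                           ≡⟨ ×ℚ≡*ℚ a _ ⟩
  A *ℚ rx                                ≡⟨ ℚ.*-identityʳ _ ⟨
  (A *ℚ rx) *ℚ 1ℚ                        ≡⟨ cong ((A *ℚ rx) *ℚ_) (yry≡1) ⟨
  (A *ℚ rx) *ℚ (Y *ℚ ry)                 ≡⟨ solve 4 (λ A rx Y ry → (A :* rx) :* (Y :* ry) := (Y :* A) :* (rx :* ry)) refl A rx Y ry ⟩
  (Y *ℚ A) *ℚ (rx *ℚ ry)                 ≡⟨ cong (_*ℚ (rx *ℚ ry)) cast ⟩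
  (X *ℚ B) *ℚ (rx *ℚ ry)                 ≡⟨ solve 4 (λ X B rx ry → (X :* B) :* (rx :* ry) := (B :* ry) :* (X :* rx)) refl X B rx ry ⟩
  (B *ℚ ry) *ℚ (X *ℚ rx)                 ≡⟨ cong ((B *ℚ ry) *ℚ_) xrx≡1 ⟩
  (B *ℚ ry) *ℚ 1ℚ                        ≡⟨ ℚ.*-identityʳ _ ⟩
  B *ℚ ry                                ≡⟨ ×ℚ≡*ℚ b _ ⟨
  b ×ℚ recip y                           ∎
  where
  open ≡-Reasoning
  open +-*-Solver using (solve; _:*_; _:=_)
  A = a ×ℚ 1ℚ ; B = b ×ℚ 1ℚ ; X = x ×ℚ 1ℚ ; Y = y ×ℚ 1ℚ ; rx = recip x ; ry = recip y
  xrx≡1 : X *ℚ rx ≡ 1ℚ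
  xrx≡1 = trans (sym (×ℚ≡*ℚ x rx)) (×ℚ-recip x x≢0)
  yry≡1 : Y *ℚ ry ≡ 1ℚ
  yry≡1 = trans (sym (×ℚ≡*ℚ y ry)) (×ℚ-recip y y≢0)
  cast : Y *ℚ A ≡ X *ℚ B
  cast = trans (sym (×1-homo-* y a)) (trans (cong (_×ℚ 1ℚ) (sym xb≡ya)) (×1-homo-* x b))

×ℚ1-injective : ∀ m n → m ×ℚ 1ℚ ≡ n ×ℚ 1ℚ → m ≡ n
×ℚ1-injective zero    zero    _ = refl
×ℚ1-injective zero    (suc n) e = contradiction (subst Positive (sym e) (suc×ℚ1-positive n)) λ ()
×ℚ1-injective (suc m) zero    e = contradiction (subst Positive e (suc×ℚ1-positive m)) λ ()
×ℚ1-injective (suc m) (suc n) e = cong suc (×ℚ1-injective m n (ℚ+.∙-cancelˡ 1ℚ _ _ e))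

unitLineSums⇒square : ∀ {a b} (S : Fin a → Fin b → ℚ) →
  (∀ i → sumℚ b (S i) ≡ 1ℚ) → (∀ j → sumℚ a (λ i → S i j) ≡ 1ℚ) → a ≡ b
unitLineSums⇒square {a} {b} S rows cols = ×ℚ1-injective a b (begin
  a ×ℚ 1ℚ                              ≡⟨ ℚΣ.sum-replicate a ⟨
  ℚΣ.sum {a} (λ _ → 1ℚ)                ≡⟨ ℚΣ.sum-cong-≗ (λ i → trans (sym (rows i)) (sumℚ≡∑ b (S i))) ⟩
  ℚΣ.sum (λ i → ℚΣ.sum (S i))          ≡⟨ ℚΣ.∑-comm S ⟩
  ℚΣ.sum (λ j → ℚΣ.sum (λ i → S i j))  ≡⟨ ℚΣ.sum-cong-≗ (λ j → trans (sym (sumℚ≡∑ a _)) (cols j)) ⟩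
  ℚΣ.sum {b} (λ _ → 1ℚ)                ≡⟨ ℚΣ.sum-replicate b ⟩
  b ×ℚ 1ℚ                              ∎)
  where open ≡-Reasoning

if-*-indicator : ∀ b c x → (if b then x else 0ℚ) *ℚ (if c then 1ℚ else 0ℚ) ≡ (if b ∧ c then x else 0ℚ)
if-*-indicator true  true  x = ℚ.*-identityʳ x
if-*-indicator true  false x = ℚ.*-zeroʳ x
if-*-indicator false c     x = ℚ.*-zeroˡ (if c then 1ℚ else 0ℚ)

module Averaging {T : Set} (_≟ᵀ_ : DecidableEquality T) where

  fibreSize : ∀ {a} → (Fin a → T) → T → ℕ
  fibreSize {a} ℓ t = count a (λ k → ⌊ ℓ k ≟ᵀ t ⌋)

  averaging : ∀ {a b} → (Fin a → T) → (Fin b → T) → Fin b → Fin a → ℚ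
  averaging ℓ ℓ′ i k = if ⌊ ℓ k ≟ᵀ ℓ′ i ⌋ then recip (fibreSize ℓ (ℓ′ i)) else 0ℚ

  fibreSize-nonzero : ∀ {a} (ℓ : Fin a → T) k → fibreSize ℓ (ℓ k) ≢ 0
  fibreSize-nonzero {a} ℓ k = count-nonzero a _ k (⌊⌋-yes (ℓ k ≟ᵀ ℓ k) refl)

  private
    recip-fibreSize-cong : ∀ {a} (ℓ : Fin a → T) {t u} → ⌊ t ≟ᵀ u ⌋ ≡ true →
                           recip (fibreSize ℓ u) ≡ recip (fibreSize ℓ t)
    recip-fibreSize-cong ℓ {t} {u} t≟u = cong (recip ∘ fibreSize ℓ) (sym (⌊⌋-true⇒ (t ≟ᵀ u) t≟u))

    count-flip : ∀ {a b} (ℓ : Fin a → T) (ℓ′ : Fin b → T) k (B : Fin b → Bool) →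
                 count b (λ i → ⌊ ℓ k ≟ᵀ ℓ′ i ⌋ ∧ B i) ≡ count b (λ i → ⌊ ℓ′ i ≟ᵀ ℓ k ⌋ ∧ B i)
    count-flip {b = b} ℓ ℓ′ k B = count-cong b (λ i → cong (_∧ B i) (⌊≟⌋-sym _≟ᵀ_ (ℓ k) (ℓ′ i)))

  ∑-averaging-row : ∀ {a b} (ℓ : Fin a → T) (ℓ′ : Fin b → T) i (B : Fin a → Bool) →
    sumℚ a (λ k → averaging ℓ ℓ′ i k *ℚ (if B k then 1ℚ else 0ℚ))
      ≡ count a (λ k → ⌊ ℓ k ≟ᵀ ℓ′ i ⌋ ∧ B k) ×ℚ recip (fibreSize ℓ (ℓ′ i))
  ∑-averaging-row {a} ℓ ℓ′ i B =
    trans (sumℚ-cong a (λ k → if-*-indicator ⌊ ℓ k ≟ᵀ ℓ′ i ⌋ (B k) _))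
          (sumℚ-if a _ _ _ (λ _ _ → refl))

  ∑-averaging-column : ∀ {a b} (ℓ : Fin a → T) (ℓ′ : Fin b → T) k (B : Fin b → Bool) →
    sumℚ b (λ i → averaging ℓ ℓ′ i k *ℚ (if B i then 1ℚ else 0ℚ))
      ≡ count b (λ i → ⌊ ℓ′ i ≟ᵀ ℓ k ⌋ ∧ B i) ×ℚ recip (fibreSize ℓ (ℓ k))
  ∑-averaging-column {b = b} ℓ ℓ′ k B = begin
    sumℚ b (λ i → averaging ℓ ℓ′ i k *ℚ (if B i then 1ℚ else 0ℚ))
      ≡⟨ sumℚ-cong b (λ i → if-*-indicator ⌊ ℓ k ≟ᵀ ℓ′ i ⌋ (B i) _) ⟩
    sumℚ b (λ i → if ⌊ ℓ k ≟ᵀ ℓ′ i ⌋ ∧ B i then recip (fibreSize ℓ (ℓ′ i)) else 0ℚ)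
      ≡⟨ sumℚ-if b _ _ _ (λ i h → recip-fibreSize-cong ℓ (∧-conicalˡ _ _ h)) ⟩
    count b (λ i → ⌊ ℓ k ≟ᵀ ℓ′ i ⌋ ∧ B i) ×ℚ recip (fibreSize ℓ (ℓ k))
      ≡⟨ cong (_×ℚ recip (fibreSize ℓ (ℓ k))) (count-flip ℓ ℓ′ k B) ⟩
    count b (λ i → ⌊ ℓ′ i ≟ᵀ ℓ k ⌋ ∧ B i) ×ℚ recip (fibreSize ℓ (ℓ k))
      ∎
    where open ≡-Reasoning

  averaging-doublyStochastic : ∀ {a b} (ℓ : Fin a → T) (ℓ′ : Fin b → T) →
    (∀ t → fibreSize ℓ t ≡ fibreSize ℓ′ t) → DoublyStochastic (averaging ℓ ℓ′)
  averaging-doublyStochastic {a} {b} ℓ ℓ′ sizes =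
    unitLineSums⇒square (averaging ℓ ℓ′) rows columns , nonNegative , rows , columns
    where
    nonNegative : ∀ i k → 0ℚ ≤ averaging ℓ ℓ′ i k
    nonNegative i k with ⌊ ℓ k ≟ᵀ ℓ′ i ⌋
    ... | true  = recip-nonNegative (fibreSize ℓ (ℓ′ i))
    ... | false = ℚ.≤-refl
    rows : ∀ i → sumℚ a (averaging ℓ ℓ′ i) ≡ 1ℚ
    rows i = trans (sumℚ-if a _ _ _ (λ _ _ → refl))
                   (×ℚ-recip _ (λ z → fibreSize-nonzero ℓ′ i (trans (sym (sizes (ℓ′ i))) z)))
    columns : ∀ k → sumℚ b (λ i → averaging ℓ ℓ′ i k) ≡ 1ℚ
    columns k = begin
      sumℚ b (λ i → averaging ℓ ℓ′ i k)
        ≡⟨ sumℚ-if b _ _ _ (λ i h → recip-fibreSize-cong ℓ h) ⟩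
      count b (λ i → ⌊ ℓ k ≟ᵀ ℓ′ i ⌋) ×ℚ recip (fibreSize ℓ (ℓ k))
        ≡⟨ cong (_×ℚ recip (fibreSize ℓ (ℓ k))) (trans (count-cong b (λ i → ⌊≟⌋-sym _≟ᵀ_ (ℓ k) (ℓ′ i))) (sym (sizes (ℓ k)))) ⟩
      fibreSize ℓ (ℓ k) ×ℚ recip (fibreSize ℓ (ℓ k))
        ≡⟨ ×ℚ-recip _ (fibreSize-nonzero ℓ k) ⟩
      1ℚ ∎
      where open ≡-Reasoning

module Edges {n} (G : Graph n) where

  isEdge : Fin n × Fin n → Bool
  isEdge e = ⌊ proj₁ e <? proj₂ e ⌋ ∧ adj G (proj₁ e) (proj₂ e)

  m : ℕ
  m = length (edgeList G)

  end₁ end₂ : Fin m → Fin n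
  end₁ e = proj₁ (lookup (edgeList G) e)
  end₂ e = proj₂ (lookup (edgeList G) e)

  incident : Fin n → Fin m → Bool
  incident k e = ⌊ k ≟ end₁ e ⌋ ∨ ⌊ k ≟ end₂ e ⌋

  end₁≢end₂ : ∀ e → end₁ e ≢ end₂ e
  end₁≢end₂ e end₁≡end₂ = <-irrefl end₁≡end₂
    (⌊⌋-true⇒ (end₁ e <? end₂ e) (∧-conicalˡ _ _ (lookup-filterᵇ isEdge (cartesianProduct (allFin n) (allFin n)) e)))

  count-edges : ∀ (g : Fin n → Fin n → Bool) →
    count m (λ e → g (end₁ e) (end₂ e)) ≡ ∑[ a < n ] count n (λ b → isEdge (a , b) ∧ g a b)
  count-edges g = begin
    countᴸ (λ e → g (proj₁ e) (proj₂ e)) (filterᵇ isEdge pairs)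
      ≡⟨ countᴸ-filterᵇ isEdge (λ e → g (proj₁ e) (proj₂ e)) pairs ⟩
    countᴸ (λ e → isEdge e ∧ g (proj₁ e) (proj₂ e)) pairs
      ≡⟨ countᴸ-cartesianProduct n (λ e → isEdge e ∧ g (proj₁ e) (proj₂ e)) (λ a → a) (allFin n) ⟩
    ∑[ a < n ] countᴸ (λ b → isEdge (a , b) ∧ g a b) (allFin n)
      ≡⟨ sum-cong-≗ (λ a → countᴸ-tabulate n (λ b → isEdge (a , b) ∧ g a b) (λ b → b)) ⟩
    ∑[ a < n ] count n (λ b → isEdge (a , b) ∧ g a b)
      ∎
    where
    open ≡-Reasoning
    pairs = cartesianProduct (allFin n) (allFin n)

  count-incident : ∀ k (F : Fin n → Fin n → Bool) → (∀ a b → F a b ≡ F b a) →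
    count m (λ e → F (end₁ e) (end₂ e) ∧ incident k e) ≡ count n (λ j → adj G k j ∧ F k j)
  count-incident k F F-sym = begin
    count m (λ e → F (end₁ e) (end₂ e) ∧ incident k e)
      ≡⟨ count-edges (λ a b → F a b ∧ (⌊ k ≟ a ⌋ ∨ ⌊ k ≟ b ⌋)) ⟩
    ∑[ a < n ] count n (λ b → isEdge (a , b) ∧ (F a b ∧ (⌊ k ≟ a ⌋ ∨ ⌊ k ≟ b ⌋)))
      ≡⟨ sum-cong-≗ (λ a → trans (count≡∑ n _) (sum-cong-≗ λ b → split a b)) ⟩
    ∑[ a < n ] ∑[ b < n ] ((if ⌊ k ≟ a ⌋ then X a b else 0) + (if ⌊ k ≟ b ⌋ then X a b else 0))
      ≡⟨ trans (sum-cong-≗ {n} (λ a → ∑-distrib-+ {n} _ _)) (∑-distrib-+ {n} _ _) ⟩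
    ∑[ a < n ] ∑[ b < n ] (if ⌊ k ≟ a ⌋ then X a b else 0) + ∑[ a < n ] ∑[ b < n ] (if ⌊ k ≟ b ⌋ then X a b else 0)
      ≡⟨ cong₂ _+_ (trans (sum-cong-≗ (λ a → ∑-if-const n ⌊ k ≟ a ⌋ (X a))) (∑-if-≟ n k (λ a → ∑[ b < n ] X a b)))
                   (sum-cong-≗ (λ a → ∑-if-≟ n k (X a))) ⟩
    ∑[ j < n ] X k j + ∑[ j < n ] X j k
      ≡⟨ ∑-distrib-+ {n} _ _ ⟨
    ∑[ j < n ] (X k j + X j k)
      ≡⟨ sum-cong-≗ merge ⟩
    ∑[ j < n ] indicator (adj G k j ∧ F k j)
      ≡⟨ count≡∑ n _ ⟨
    count n (λ j → adj G k j ∧ F k j)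
      ∎
    where
    open ≡-Reasoning
    X : Fin n → Fin n → ℕ
    X a b = indicator (isEdge (a , b) ∧ F a b)

    no-loops : ∀ a b → (isEdge (a , b) ∧ F a b) ∧ (⌊ k ≟ a ⌋ ∧ ⌊ k ≟ b ⌋) ≡ false
    no-loops a b with k ≟ a | k ≟ b
    ... | yes refl | yes refl rewrite ⌊⌋-no (k <? k) (<-irrefl refl) = refl
    ... | yes _    | no _     = ∧-zeroʳ _
    ... | no _     | _        = ∧-zeroʳ _

    split : ∀ a b → indicator (isEdge (a , b) ∧ (F a b ∧ (⌊ k ≟ a ⌋ ∨ ⌊ k ≟ b ⌋)))
                  ≡ (if ⌊ k ≟ a ⌋ then X a b else 0) + (if ⌊ k ≟ b ⌋ then X a b else 0)
    split a b = trans (cong indicator (sym (∧-assoc (isEdge (a , b)) (F a b) _)))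
                      (indicator-∧-∨ _ ⌊ k ≟ a ⌋ ⌊ k ≟ b ⌋ (no-loops a b))

    merge : ∀ j → X k j + X j k ≡ indicator (adj G k j ∧ F k j)
    merge j with <-cmp k j
    ... | tri< k<j _ k≯j rewrite ⌊⌋-yes (k <? j) k<j | ⌊⌋-no (j <? k) k≯j = ℕ.+-identityʳ _
    ... | tri≈ _ refl _  rewrite ⌊⌋-no (k <? k) (<-irrefl refl) | irrefl G k = refl
    ... | tri> k≮j _ j<k rewrite ⌊⌋-no (k <? j) k≮j | ⌊⌋-yes (j <? k) j<k | Graph.sym G j k | F-sym j k = refl

HasDegreeMatrix : ∀ {n s} → Graph n → (Fin n → Fin s) → (Fin s → Fin s → ℕ) → Set
HasDegreeMatrix G p D = ∀ x j → deg G p x j ≡ D (p x) j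

-- An edge with ends in parts c and c′ has type c + c′, which determines the multiset {c, c′}.
pairType : Fin 2 → Fin 2 → ℕ
pairType c c′ = toℕ c + toℕ c′

endpointsIn : Fin 2 → ℕ → ℕ
endpointsIn zero       t = 2 ∸ t
endpointsIn (suc zero) t = t

edgesOfTypeAt : (Fin 2 → ℕ) → Fin 2 → ℕ → ℕ
edgesOfTypeAt d c t = ∑[ j < 2 ] (if ⌊ pairType c j ℕ.≟ t ⌋ then d j else 0)

endpointsIn-pairType : ∀ x y c → indicator ⌊ x ≟ c ⌋ + indicator ⌊ y ≟ c ⌋ ≡ endpointsIn c (pairType x y)
endpointsIn-pairType zero       zero       zero       = refl
endpointsIn-pairType zero       zero       (suc zero) = refl
endpointsIn-pairType zero       (suc zero) zero       = refl
endpointsIn-pairType zero       (suc zero) (suc zero) = refl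
endpointsIn-pairType (suc zero) zero       zero       = refl
endpointsIn-pairType (suc zero) zero       (suc zero) = refl
endpointsIn-pairType (suc zero) (suc zero) zero       = refl
endpointsIn-pairType (suc zero) (suc zero) (suc zero) = refl

*-endpointsIn-cancel : ∀ {x y} t → (∀ c → x * endpointsIn c t ≡ y * endpointsIn c t) → x ≡ y
*-endpointsIn-cancel {x} {y} zero    h = ℕ.*-cancelʳ-≡ x y 2 (h zero)
*-endpointsIn-cancel {x} {y} (suc t) h = ℕ.*-cancelʳ-≡ x y (suc t) (h (suc zero))

private
  module Parts = Averaging {T = Fin 2} _≟_
  module Types = Averaging ℕ._≟_

module EdgeTypes {n} (G : Graph n) (p : Fin n → Fin 2) where
  open Edges G public

  type : Fin m → ℕ
  type e = pairType (p (end₁ e)) (p (end₂ e))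

  typeCount : ℕ → ℕ
  typeCount = Types.fibreSize type

  count-endpoints : ∀ c e → count n (λ k → ⌊ p k ≟ c ⌋ ∧ incident k e) ≡ endpointsIn c (type e)
  count-endpoints c e = trans (count-∧-either n (λ k → ⌊ p k ≟ c ⌋) (end₁≢end₂ e))
                              (endpointsIn-pairType (p (end₁ e)) (p (end₂ e)) c)

  module _ {D : Fin 2 → Fin 2 → ℕ} (degrees : HasDegreeMatrix G p D) where

    count-incident-of-type : ∀ k t →
      count m (λ e → ⌊ type e ℕ.≟ t ⌋ ∧ incident k e) ≡ edgesOfTypeAt (D (p k)) (p k) t
    count-incident-of-type k t = begin
      count m (λ e → ⌊ type e ℕ.≟ t ⌋ ∧ incident k e)
        ≡⟨ count-incident k (λ a b → ⌊ pairType (p a) (p b) ℕ.≟ t ⌋)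
                            (λ a b → cong (λ s → ⌊ s ℕ.≟ t ⌋) (ℕ.+-comm (toℕ (p a)) (toℕ (p b)))) ⟩
      count n (λ j → adj G k j ∧ ⌊ pairType (p k) (p j) ℕ.≟ t ⌋)
        ≡⟨ count-∧-fibres n 2 (adj G k) p (λ j → ⌊ pairType (p k) j ℕ.≟ t ⌋) ⟩
      ∑[ j < 2 ] (if ⌊ pairType (p k) j ℕ.≟ t ⌋ then deg G p k j else 0)
        ≡⟨ sum-cong-≗ {2} (λ j → cong (λ d → if ⌊ pairType (p k) j ℕ.≟ t ⌋ then d else 0) (degrees k j)) ⟩
      edgesOfTypeAt (D (p k)) (p k) t
        ∎
      where open ≡-Reasoning

    double-count : ∀ c t → partSize p c * edgesOfTypeAt (D c) c t ≡ typeCount t * endpointsIn c t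
    double-count c t = begin
      partSize p c * edgesOfTypeAt (D c) c t
        ≡⟨ ∑-if n (λ k → ⌊ p k ≟ c ⌋) (λ k → count m (λ e → ⌊ type e ℕ.≟ t ⌋ ∧ incident k e)) _
                (λ k pk≟c → trans (count-incident-of-type k t)
                                  (cong (λ c′ → edgesOfTypeAt (D c′) c′ t) (⌊⌋-true⇒ (p k ≟ c) pk≟c))) ⟨
      ∑[ k < n ] (if ⌊ p k ≟ c ⌋ then count m (λ e → ⌊ type e ℕ.≟ t ⌋ ∧ incident k e) else 0)
        ≡⟨ sum-cong-≗ {n} (λ k → count-∧-if m (λ _ → true) _ ⌊ p k ≟ c ⌋) ⟨
      ∑[ k < n ] count m (λ e → ⌊ p k ≟ c ⌋ ∧ (⌊ type e ℕ.≟ t ⌋ ∧ incident k e))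
        ≡⟨ ∑-count-comm n m _ ⟩
      ∑[ e < m ] count n (λ k → ⌊ p k ≟ c ⌋ ∧ (⌊ type e ℕ.≟ t ⌋ ∧ incident k e))
        ≡⟨ sum-cong-≗ {m} (λ e → count-∧-if n (λ k → ⌊ p k ≟ c ⌋) (λ k → incident k e) _) ⟩
      ∑[ e < m ] (if ⌊ type e ℕ.≟ t ⌋ then count n (λ k → ⌊ p k ≟ c ⌋ ∧ incident k e) else 0)
        ≡⟨ ∑-if m (λ e → ⌊ type e ℕ.≟ t ⌋) _ _
                (λ e te≟t → trans (count-endpoints c e) (cong (endpointsIn c) (⌊⌋-true⇒ (type e ℕ.≟ t) te≟t))) ⟩
      typeCount t * endpointsIn c t
        ∎
      where open ≡-Reasoning

module _ {n n′} (G : Graph n) (H : Graph n′) {p : Fin n → Fin 2} {q : Fin n′ → Fin 2} {D : Fin 2 → Fin 2 → ℕ}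
         (degreesG : HasDegreeMatrix G p D) (degreesH : HasDegreeMatrix H q D)
         (sizes : ∀ c → partSize p c ≡ partSize q c) where

  private
    module G′ = EdgeTypes G p
    module H′ = EdgeTypes H q

    typeCounts : ∀ t → G′.typeCount t ≡ H′.typeCount t
    typeCounts t = *-endpointsIn-cancel t λ c →
      trans (sym (G′.double-count {D} degreesG c t)) (trans (cong (_* _) (sizes c)) (H′.double-count {D} degreesH c t))

    balance : ∀ c t → partSize p c ≢ 0 → H′.typeCount t ≢ 0 →
              endpointsIn c t ×ℚ recip (partSize p c) ≡ edgesOfTypeAt (D c) c t ×ℚ recip (H′.typeCount t)
    balance c t v≢0 N≢0 = ×ℚ-recip-cross _ _ _ _ v≢0 N≢0
      (trans (G′.double-count {D} degreesG c t) (cong (_* endpointsIn c t) (typeCounts t)))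

    S₁ : Fin n′ → Fin n → ℚ
    S₁ = Parts.averaging p q

    S₂ : Fin G′.m → Fin H′.m → ℚ
    S₂ = Types.averaging H′.type G′.type

    S₁M≡MS₂ᵗ : ∀ i e → sumℚ n (λ k → S₁ i k *ℚ incMat (toHypergraph G) k e)
                     ≡ sumℚ H′.m (λ e′ → incMat (toHypergraph H) i e′ *ℚ S₂ e e′)
    S₁M≡MS₂ᵗ i e = begin
      sumℚ n (λ k → S₁ i k *ℚ incMat (toHypergraph G) k e)
        ≡⟨ Parts.∑-averaging-row p q i (λ k → G′.incident k e) ⟩
      count n (λ k → ⌊ p k ≟ q i ⌋ ∧ G′.incident k e) ×ℚ recip (partSize p (q i))
        ≡⟨ cong (_×ℚ recip (partSize p (q i))) (G′.count-endpoints (q i) e) ⟩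
      endpointsIn (q i) t ×ℚ recip (partSize p (q i))
        ≡⟨ balance (q i) t (λ v≡0 → Parts.fibreSize-nonzero q i (trans (sym (sizes (q i))) v≡0))
                           (λ N≡0 → Types.fibreSize-nonzero G′.type e (trans (typeCounts t) N≡0)) ⟩
      edgesOfTypeAt (D (q i)) (q i) t ×ℚ recip (H′.typeCount t)
        ≡⟨ cong (_×ℚ recip (H′.typeCount t)) (H′.count-incident-of-type {D} degreesH i t) ⟨
      count H′.m (λ e′ → ⌊ H′.type e′ ℕ.≟ t ⌋ ∧ H′.incident i e′) ×ℚ recip (H′.typeCount t)
        ≡⟨ Types.∑-averaging-row H′.type G′.type e (H′.incident i) ⟨
      sumℚ H′.m (λ e′ → S₂ e e′ *ℚ incMat (toHypergraph H) i e′)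
        ≡⟨ sumℚ-cong H′.m (λ e′ → ℚ.*-comm (S₂ e e′) _) ⟩
      sumℚ H′.m (λ e′ → incMat (toHypergraph H) i e′ *ℚ S₂ e e′)
        ∎
      where
      open ≡-Reasoning
      t = G′.type e

    MS₂≡S₁ᵗM : ∀ k e′ → sumℚ G′.m (λ e → incMat (toHypergraph G) k e *ℚ S₂ e e′)
                      ≡ sumℚ n′ (λ i → S₁ i k *ℚ incMat (toHypergraph H) i e′)
    MS₂≡S₁ᵗM k e′ = begin
      sumℚ G′.m (λ e → incMat (toHypergraph G) k e *ℚ S₂ e e′)
        ≡⟨ sumℚ-cong G′.m (λ e → ℚ.*-comm _ (S₂ e e′)) ⟩
      sumℚ G′.m (λ e → S₂ e e′ *ℚ incMat (toHypergraph G) k e)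
        ≡⟨ Types.∑-averaging-column H′.type G′.type e′ (G′.incident k) ⟩
      count G′.m (λ e → ⌊ G′.type e ℕ.≟ t ⌋ ∧ G′.incident k e) ×ℚ recip (H′.typeCount t)
        ≡⟨ cong (_×ℚ recip (H′.typeCount t)) (G′.count-incident-of-type {D} degreesG k t) ⟩
      edgesOfTypeAt (D (p k)) (p k) t ×ℚ recip (H′.typeCount t)
        ≡⟨ balance (p k) t (Parts.fibreSize-nonzero p k) (Types.fibreSize-nonzero H′.type e′) ⟨
      endpointsIn (p k) t ×ℚ recip (partSize p (p k))
        ≡⟨ cong (_×ℚ recip (partSize p (p k))) (H′.count-endpoints (p k) e′) ⟨
      count n′ (λ i → ⌊ q i ≟ p k ⌋ ∧ H′.incident i e′) ×ℚ recip (partSize p (p k))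
        ≡⟨ Parts.∑-averaging-column p q k (λ i → H′.incident i e′) ⟨
      sumℚ n′ (λ i → S₁ i k *ℚ incMat (toHypergraph H) i e′)
        ∎
      where
      open ≡-Reasoning
      t = H′.type e′

  twoPartEquitable⇒≡ᴴ : toHypergraph G ≡ᴴ toHypergraph H
  twoPartEquitable⇒≡ᴴ = inj₂ (S₁ , S₂ , Parts.averaging-doublyStochastic p q sizes ,
                     Types.averaging-doublyStochastic H′.type G′.type (sym ∘ typeCounts) , S₁M≡MS₂ᵗ , MS₂≡S₁ᵗM)

AlignedParameters : ∀ {n n′ s} → Graph n → (Fin n → Fin s) → Graph n′ → (Fin n′ → Fin s) → Set
AlignedParameters G p H q =
  (∀ c → partSize p c ≡ partSize q c) × (∀ x y → p x ≡ q y → ∀ j → deg G p x j ≡ deg H q y j)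

sameParameters⇒aligned : ∀ {n n′ s} {G : Graph n} {p : Fin n → Fin s} {H : Graph n′} {q : Fin n′ → Fin s}
  (same : SameParameters G p H q) → AlignedParameters G p H (Inverse.from (proj₁ same) ∘ q)
sameParameters⇒aligned {n′ = n′} {G = G} {p} {H} {q} (σ , sizes , degrees) = sizes′ , degrees′
  where
  open Inverse σ using (to; from; strictlyInverseˡ; strictlyInverseʳ)
  relabel : ∀ y c → ⌊ from (q y) ≟ c ⌋ ≡ ⌊ q y ≟ to c ⌋
  relabel y c = ⌊⌋-⇔ (mk⇔ (λ e → trans (sym (strictlyInverseˡ (q y))) (cong to e))
                          (λ e → trans (cong from e) (strictlyInverseʳ c))) _ _
  sizes′ : ∀ c → partSize p c ≡ partSize (from ∘ q) c
  sizes′ c = trans (sizes c) (sym (count-cong n′ (λ y → relabel y c)))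
  degrees′ : ∀ x y → p x ≡ from (q y) → ∀ j → deg G p x j ≡ deg H (from ∘ q) y j
  degrees′ x y px≡ j = trans (degrees x y (trans (cong to px≡) (strictlyInverseˡ (q y))) j)
                             (sym (count-cong n′ (λ z → cong (adj H y z ∧_) (relabel z j))))

equitable⇒hasDegreeMatrix : ∀ {n s} {G : Graph n} {p : Fin n → Fin s} (equitable : IsEquitable G p) →
  HasDegreeMatrix G p (λ c → deg G p (proj₁ (proj₁ equitable c)))
equitable⇒hasDegreeMatrix {p = p} (partition , regular) x = regular x _ (sym (proj₂ (partition (p x))))

aligned⇒hasDegreeMatrix : ∀ {n n′ s} {G : Graph n} {p : Fin n → Fin s} {H : Graph n′} {q : Fin n′ → Fin s} {D} →
  IsPartition p → HasDegreeMatrix G p D → AlignedParameters G p H q → HasDegreeMatrix H q D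
aligned⇒hasDegreeMatrix {p = p} {q = q} {D} partition degrees (_ , aligned) y j
  with partition (q y)
... | x , px≡qy = trans (sym (aligned x y px≡qy j)) (trans (degrees x j) (cong (λ c → D c j) px≡qy))

mainTheorem6 : ∀ {n n'} (G : Graph n) (H : Graph n')
    (p : Fin n → Fin 2) (q : Fin n' → Fin 2) →
    IsCoarsestEquitable G p → IsCoarsestEquitable H q →
    SameParameters G p H q →
    toHypergraph G ≡ᴴ toHypergraph H
mainTheorem6 G H p q ((partition , regular) , _) _ same =
  twoPartEquitable⇒≡ᴴ G H {q = Inverse.from (proj₁ same) ∘ q} {D = D} degreesG
    (aligned⇒hasDegreeMatrix {G = G} {H = H} {D = D} partition degreesG aligned) (proj₁ aligned)
  where
  D : Fin 2 → Fin 2 → ℕ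
  D c = deg G p (proj₁ (partition c))
  degreesG : HasDegreeMatrix G p D
  degreesG = equitable⇒hasDegreeMatrix {G = G} (partition , regular)
  aligned : AlignedParameters G p H (Inverse.from (proj₁ same) ∘ q)
  aligned = sameParameters⇒aligned {G = G} {H = H} same
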